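{- Let $N$ be a natural number, $P=\{a\subseteq N:|a|\geq 2\}$, let $g:P\to P$ be a polygon-reducing function and let $\psi_g$ be as defined in the context. Then for every $A\subseteq P$, $\|A\|_3\leq \|\psi_g(A)\|_3$.
   Context: $N$ is identified with $\{0,\ldots,N-1\}$. For $A\subseteq P$ and $z\subseteq N$ let $A\restriction z=\{a\in A: a\subseteq z\}$. The graph coloring norm is defined recursively: $\|A\|_3\geq 0$ always; $\|A\|_3\geq 1$ iff $A\neq\emptyset$; for $n\geq 1$, $\|A\|_3\geq n+1$ iff for every $z\subseteq N$, either $\|A\restriction z\|_3\geq n$ or $\|A\restriction (N\setminus z)\|_3\geq n$; $\|A\|_3=n$ means $\|A\|_3\geq n$ but not $\|A\|_3\geq n+1$. An edge is a 2-element subset of $N$. Define $f:\mathcal P(N)\to\omega$ by $f(a)=a_0N^0+a_1N^1+\cdots+a_kN^k$ where $a=\{a_0,\ldots,a_k\}$ with $a_0<a_1<\cdots<a_k$. A function $g:P\to P$ is polygon-reducing if $g(a)\subseteq a$ for all $a\in P$, and $g(a)=a$ iff $a$ is an edge. For non-empty $A\subseteq P$, let $a\in A$ be the element with $f(a)=\max\{f(a'):a'\in A\}$ and set $\psi_g(A)=(A\setminus\{a\})\cup\{g(a)\}$; also $\psi_g(\emptyset)=\emptyset$. -}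

module Defs where

open import Data.Nat using (ℕ; zero; suc; _+_; _*_; _^_; _≤_; _<ᵇ_)
open import Data.Bool using (Bool; true; false; T; _∧_; _∨_; not; if_then_else_)
import Data.Bool.Properties as BoolP
open import Data.Fin using (Fin)
open import Data.Fin.Subset using (Subset; ∣_∣; _⊆_; ∁)
open import Data.Fin.Subset.Properties using (_⊆?_)
open import Data.Vec using (Vec; []; _∷_)
open import Data.Vec.Properties using (≡-dec)
open import Data.List using (List; []; _∷_; _++_; map; filterᵇ)
open import Data.Maybe using (Maybe; nothing; just)
open import Data.Product using (Σ; _×_)
open import Data.Sum using (_⊎_)
open import Data.Unit using (⊤)
open import Relation.Nullary using (¬_)
open import Relation.Nullary.Decidable using (⌊_⌋)
open import Relation.Binary.PropositionalEquality using (_≡_)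
open import Function.Bundles using (_⇔_)

-- Subsets of N = {0,…,N-1} are 'Subset N' (Vec Bool N); position i ↔ element i.
Family : ℕ → Set
Family N = Subset N → Bool

InP : {N : ℕ} → Subset N → Set
InP a = 2 ≤ ∣ a ∣

IsEdge : {N : ℕ} → Subset N → Set
IsEdge a = ∣ a ∣ ≡ 2

_≟ˢ_ : {N : ℕ} → (a b : Subset N) → Bool
a ≟ˢ b = ⌊ ≡-dec BoolP._≟_ a b ⌋

_↾_ : {N : ℕ} → Family N → Subset N → Family N
(A ↾ z) a = A a ∧ ⌊ a ⊆? z ⌋

Nonempty : {N : ℕ} → Family N → Set
Nonempty {N} A = Σ (Subset N) (λ a → T (A a))

-- NormGe A n  ⇔  ‖A‖₃ ≥ n   (recursive definition of the graph coloring norm)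
NormGe : {N : ℕ} → Family N → ℕ → Set
NormGe A zero = ⊤
NormGe A (suc zero) = Nonempty A
NormGe {N} A (suc (suc n)) =
  (z : Subset N) → NormGe (A ↾ z) (suc n) ⊎ NormGe (A ↾ ∁ z) (suc n)

elems : {N : ℕ} → Subset N → List ℕ
elems [] = []
elems (b ∷ p) = (if b then 0 ∷ [] else []) ++ map suc (elems p)

fsum : ℕ → ℕ → List ℕ → ℕ
fsum N k [] = 0
fsum N k (x ∷ xs) = x * N ^ k + fsum N (suc k) xs

f : {N : ℕ} → Subset N → ℕ
f {N} a = fsum N 0 (elems a)

allSubsets : (N : ℕ) → List (Subset N)
allSubsets zero = [] ∷ []
allSubsets (suc N) = map (false ∷_) (allSubsets N) ++ map (true ∷_) (allSubsets N)

maxF : {N : ℕ} → List (Subset N) → Maybe (Subset N)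
maxF [] = nothing
maxF (a ∷ as) with maxF as
... | nothing = just a
... | just b = if f a <ᵇ f b then just b else just a

PolygonReducing : {N : ℕ} → (Subset N → Subset N) → Set
PolygonReducing {N} g = (a : Subset N) → InP a →
  (g a ⊆ a) × InP (g a) × ((g a ≡ a) ⇔ IsEdge a)

ψ : {N : ℕ} → (Subset N → Subset N) → Family N → Family N
ψ {N} g A with maxF (filterᵇ A (allSubsets N))
... | nothing = A
... | just a = λ x → (A x ∧ not (x ≟ˢ a)) ∨ (x ≟ˢ g a)

-- Call B a refinement of A when every member of A contains a member of B.
-- The norm is monotone under refinement: a witness b ⊆ a of a ∈ A ↾ z lies in
-- B ↾ z, so refinements commute with restriction and the recursion goes through.
-- ψ_g(A) refines A, because the single member a it removes is replaced by
-- g(a) ⊆ a and every other member of A is kept.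
module Submission where

open import Defs
open import Data.Nat using (ℕ; zero; suc; _<ᵇ_)
open import Data.Bool using (true; false; T; _∧_; _∨_; not)
open import Data.Bool.Properties as BoolP using (T-∧; T-∨)
open import Data.Fin.Subset using (Subset; _⊆_; ∁)
open import Data.Fin.Subset.Properties using (_⊆?_; ⊆-trans)
open import Data.Vec.Properties using (≡-dec)
open import Data.List using (List; _∷_; filterᵇ)
open import Data.List.Relation.Unary.All using (All; _∷_)
open import Data.List.Relation.Unary.All.Properties using (all-filter)
open import Data.Maybe using (nothing; just)
open import Data.Product using (∃; _×_; _,_; proj₁)
open import Data.Sum using (inj₁; inj₂)
open import Data.Unit using (tt)
open import Function using (_∘_; id)
open import Function.Bundles using (Equivalence)
open import Relation.Nullary using (yes; no)
open import Relation.Nullary.Decidable using (⌊_⌋; T?; toWitness; fromWitness; fromWitnessFalse)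
open import Relation.Binary.PropositionalEquality using (_≡_; refl)

private
  variable
    N : ℕ

_⊑_ : Family N → Family N → Set
_⊑_ {N} A B = (a : Subset N) → T (A a) → ∃ λ b → T (B b) × b ⊆ a

↾-mono-⊑ : {A B : Family N} (z : Subset N) → A ⊑ B → (A ↾ z) ⊑ (B ↾ z)
↾-mono-⊑ z A⊑B a a∈A↾z with Equivalence.to T-∧ a∈A↾z
... | a∈A , a⊆z with A⊑B a a∈A
... | b , b∈B , b⊆a =
  b , Equivalence.from T-∧ (b∈B , b⊆z) , b⊆a
  where
  b⊆z : T ⌊ b ⊆? z ⌋
  b⊆z = fromWitness {a? = b ⊆? z} (⊆-trans b⊆a (toWitness {a? = a ⊆? z} a⊆z))

normGe-mono-⊑ : {A B : Family N} → A ⊑ B → (n : ℕ) → NormGe A n → NormGe B n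
normGe-mono-⊑ A⊑B zero _ = tt
normGe-mono-⊑ A⊑B (suc zero) (a , a∈A) with A⊑B a a∈A
... | b , b∈B , _ = b , b∈B
normGe-mono-⊑ A⊑B (suc (suc n)) ‖A‖≥n+2 z with ‖A‖≥n+2 z
... | inj₁ ‖A↾z‖ = inj₁ (normGe-mono-⊑ (↾-mono-⊑ z A⊑B) (suc n) ‖A↾z‖)
... | inj₂ ‖A↾∁z‖ = inj₂ (normGe-mono-⊑ (↾-mono-⊑ (∁ z) A⊑B) (suc n) ‖A↾∁z‖)

≟ˢ-refl : (a : Subset N) → T (a ≟ˢ a)
≟ˢ-refl a = fromWitness {a? = ≡-dec BoolP._≟_ a a} refl

replace : Family N → Subset N → Subset N → Family N
replace A a b x = (A x ∧ not (x ≟ˢ a)) ∨ (x ≟ˢ b)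

⊑-replace : (A : Family N) {a b : Subset N} → b ⊆ a → A ⊑ replace A a b
⊑-replace A {a} {b} b⊆a x x∈A with ≡-dec BoolP._≟_ x a
... | no x≢a = x , Equivalence.from T-∨ (inj₁ (Equivalence.from T-∧
               (x∈A , fromWitnessFalse x≢a))) , id
... | yes refl = b , Equivalence.from T-∨ (inj₂ (≟ˢ-refl b)) , b⊆a

maxF-All : {P : Subset N → Set} {as : List (Subset N)} {a : Subset N} →
           All P as → maxF as ≡ just a → P a
maxF-All {as = x ∷ as} (Px ∷ Pas) eq with maxF as in eq′
... | nothing with refl ← eq = Px
... | just b with f x <ᵇ f b
...   | true with refl ← eq = maxF-All Pas eq′
...   | false with refl ← eq = Px

mainTheorem8 : (N : ℕ) (g : Subset N → Subset N) → PolygonReducing g →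
    (A : Family N) → ((a : Subset N) → T (A a) → InP a) →
    (n : ℕ) → NormGe A n → NormGe (ψ g A) n
mainTheorem8 N g g-reducing A A⊆P n ‖A‖≥n with maxF (filterᵇ A (allSubsets N)) in max≡a
... | nothing = ‖A‖≥n
... | just a = normGe-mono-⊑ (⊑-replace A (proj₁ (g-reducing a (A⊆P a a∈A)))) n ‖A‖≥n
  where
  a∈A : T (A a)
  a∈A = maxF-All (all-filter (T? ∘ A) (allSubsets N)) max≡a
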